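{- Let $a,b,c,n$ be positive integers with $\gcd(a,b,c)=1$. Put $g_1=\gcd(b,c)$, $g_2=\gcd(c,a)$, $g_3=\gcd(a,b)$. Let $a_1$ be an inverse of $a$ modulo $g_1$, $b_2$ an inverse of $b$ modulo $g_2$, and $c_3$ an inverse of $c$ modulo $g_3$. Let $n_1$, $n_2$, $n_3$ be the remainders upon dividing $na_1$ by $g_1$, $nb_2$ by $g_2$, and $nc_3$ by $g_3$, respectively. Let $$A=\frac{a}{g_2g_3},\quad B=\frac{b}{g_3g_1},\quad C=\frac{c}{g_1g_2},\quad N=\frac{n-an_1-bn_2-cn_3}{g_1g_2g_3}$$ (here $N$ is an integer). Then the number of solutions $(x,y,z)$ in non-negative integers of $ax+by+cz=n$ equals the number of solutions $(x,y,z)$ in non-negative integers of $Ax+By+Cz=N$.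
   Context: The inverses exist because $\gcd(a,g_1)=\gcd(b,g_2)=\gcd(c,g_3)=1$ when $\gcd(a,b,c)=1$. Remainders are the least non-negative residues. -}

module Defs where

open import Data.Nat using (ℕ; suc; _+_; _*_; NonZero; ≢-nonZero; ≢-nonZero⁻¹)
open import Data.Nat.Properties using (m*n≢0)
open import Data.Nat.GCD using (gcd; gcd[m,n]≢0)
open import Data.Integer using (ℤ; +_; ∣_∣)
import Data.Integer.Properties as ℤP
open import Data.List using (List; []; _∷_; upTo; concatMap; map; filter; length)
open import Data.Product using (_×_; _,_)
open import Data.Sum using (inj₁)
open import Relation.Binary.PropositionalEquality using (_≡_)
open import Relation.Nullary using (Dec)

gcd-nonZero : ∀ m n → {{NonZero m}} → NonZero (gcd m n)
gcd-nonZero m n = ≢-nonZero (gcd[m,n]≢0 m n (inj₁ (≢-nonZero⁻¹ m)))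

mul-nonZero : ∀ m n → {{NonZero m}} → {{NonZero n}} → NonZero (m * n)
mul-nonZero m n = m*n≢0 m n

triplesUpTo : ℕ → List (ℕ × ℕ × ℕ)
triplesUpTo k =
  concatMap (λ x → concatMap (λ y → map (λ z → x , y , z) (upTo (suc k))) (upTo (suc k)))
            (upTo (suc k))

-- Enumerates x , y , z ≤ ∣ N ∣; this counts ALL solutions whenever
-- A , B , C ≥ 1 (each coordinate of a solution is then ≤ N), which is
-- the case in the theorem.
numSolutions : ℕ → ℕ → ℕ → ℤ → ℕ
numSolutions A B C N =
  length (filter (λ { (x , y , z) → + (A * x + B * y + C * z) ℤP.≟ N })
                 (triplesUpTo ∣ N ∣))

{-# OPTIONS --safe #-}
module Submission where

-- Since g₁ divides b and c and a₁ inverts a modulo g₁, every solution of a x + b y + c z = n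
-- has x ≡ a₁ n ≡ n₁ (mod g₁); likewise y ≡ n₂ (mod g₂) and z ≡ n₃ (mod g₃). The gᵢ are
-- pairwise coprime, so a = A g₂ g₃, b = B g₃ g₁, c = C g₁ g₂, and substituting
-- x = n₁ + g₁ x′, y = n₂ + g₂ y′, z = n₃ + g₃ z′ turns the equation into
-- g₁ g₂ g₃ (A x′ + B y′ + C z′) = n - a n₁ - b n₂ - c n₃. The same congruences show that
-- each gᵢ, hence g₁ g₂ g₃, divides the right-hand side, so the substitution is a bijection
-- between the two solution sets.

open import Defs

module Enumeration where
  open import Data.Nat using (ℕ; suc; _+_; _*_; _≤_; NonZero; s≤s)
  open import Data.Nat.Properties using (m≤n*m; m≤m+n; m≤n+m; ≤-trans)
  open import Data.Integer using (ℤ; +_; ∣_∣)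
  open import Data.Integer.Properties using (_≟_)
  open import Data.List using (List; []; _∷_; _++_; map; concatMap; cartesianProductWith; cartesianProduct; filter; length; upTo)
  open import Data.List.Properties using (map-++; map-∘; concatMap-cong; length-map)
  open import Data.List.Membership.Propositional using (_∈_)
  open import Data.List.Membership.Propositional.Properties
    using (∈-filter⁺; ∈-filter⁻; ∈-map⁺; ∈-map⁻; ∈-cartesianProduct⁺; ∈-upTo⁺)
  open import Data.List.Membership.Propositional.Properties.WithK using (unique∧set⇒bag)
  open import Data.List.Relation.Unary.Unique.Propositional using (Unique)
  import Data.List.Relation.Unary.Unique.Propositional.Properties as Unique
  open import Data.List.Relation.Binary.BagAndSetEquality using (∼bag⇒↭)
  open import Data.List.Relation.Binary.Permutation.Propositional.Properties using (↭-length)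
  open import Data.Product using (_×_; _,_; ∃-syntax; proj₂)
  open import Function.Bundles using (_⇔_; mk⇔; Equivalence)
  open import Relation.Binary.PropositionalEquality using (_≡_; refl; sym; trans; cong; cong₂; module ≡-Reasoning)
  open import Relation.Nullary using (Dec)

  private
    variable
      A B C D : Set

  concatMap-map≡cartesianProductWith : (f : A → B → C) (xs : List A) (ys : List B) →
    concatMap (λ x → map (f x) ys) xs ≡ cartesianProductWith f xs ys
  concatMap-map≡cartesianProductWith f []       ys = refl
  concatMap-map≡cartesianProductWith f (x ∷ xs) ys =
    cong (map (f x) ys ++_) (concatMap-map≡cartesianProductWith f xs ys)

  map-cartesianProductWith : (g : C → D) (f : A → B → C) (xs : List A) (ys : List B) →
    map g (cartesianProductWith f xs ys) ≡ cartesianProductWith (λ x y → g (f x y)) xs ys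
  map-cartesianProductWith g f []       ys = refl
  map-cartesianProductWith g f (x ∷ xs) ys = begin
    map g (map (f x) ys ++ cartesianProductWith f xs ys)
      ≡⟨ map-++ g (map (f x) ys) _ ⟩
    map g (map (f x) ys) ++ map g (cartesianProductWith f xs ys)
      ≡⟨ cong₂ _++_ (sym (map-∘ ys)) (map-cartesianProductWith g f xs ys) ⟩
    map (λ y → g (f x y)) ys ++ cartesianProductWith (λ x y → g (f x y)) xs ys
      ∎
    where open ≡-Reasoning

  triplesUpTo≡cartesianProduct : ∀ k →
    triplesUpTo k ≡ cartesianProduct (upTo (suc k)) (cartesianProduct (upTo (suc k)) (upTo (suc k)))
  triplesUpTo≡cartesianProduct k = begin
    concatMap (λ x → concatMap (λ y → map (λ z → x , y , z) U) U) U
      ≡⟨ concatMap-cong pairs U ⟩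
    concatMap (λ x → map (x ,_) (cartesianProduct U U)) U
      ≡⟨ concatMap-map≡cartesianProductWith _,_ U (cartesianProduct U U) ⟩
    cartesianProduct U (cartesianProduct U U)
      ∎
    where
    open ≡-Reasoning
    U = upTo (suc k)
    pairs : ∀ x → concatMap (λ y → map (λ z → x , y , z) U) U ≡ map (x ,_) (cartesianProduct U U)
    pairs x = trans (concatMap-map≡cartesianProductWith (λ y z → x , y , z) U U)
                    (sym (map-cartesianProductWith (x ,_) _,_ U U))

  triplesUpTo-unique : ∀ k → Unique (triplesUpTo k)
  triplesUpTo-unique k rewrite triplesUpTo≡cartesianProduct k =
    Unique.cartesianProduct⁺ (Unique.upTo⁺ (suc k))
      (Unique.cartesianProduct⁺ (Unique.upTo⁺ (suc k)) (Unique.upTo⁺ (suc k)))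

  ∈-triplesUpTo : ∀ {k x y z} → x ≤ k → y ≤ k → z ≤ k → (x , y , z) ∈ triplesUpTo k
  ∈-triplesUpTo {k} x≤k y≤k z≤k rewrite triplesUpTo≡cartesianProduct k =
    ∈-cartesianProduct⁺ (∈-upTo⁺ (s≤s x≤k))
      (∈-cartesianProduct⁺ (∈-upTo⁺ (s≤s y≤k)) (∈-upTo⁺ (s≤s z≤k)))

  IsSolution : ℕ → ℕ → ℕ → ℤ → ℕ × ℕ × ℕ → Set
  IsSolution A B C N (x , y , z) = + (A * x + B * y + C * z) ≡ N

  isSolution? : ∀ A B C N t → Dec (IsSolution A B C N t)
  isSolution? A B C N (x , y , z) = + (A * x + B * y + C * z) ≟ N

  solutions : ℕ → ℕ → ℕ → ℤ → List (ℕ × ℕ × ℕ)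
  solutions A B C N = filter (isSolution? A B C N) (triplesUpTo ∣ N ∣)

  ∈-solutions⁻ : ∀ A B C N {t} → t ∈ solutions A B C N → IsSolution A B C N t
  ∈-solutions⁻ A B C N t∈ = proj₂ (∈-filter⁻ (isSolution? A B C N) t∈)

  ∈-solutions⁺ : ∀ {A B C N} .{{_ : NonZero A}} .{{_ : NonZero B}} .{{_ : NonZero C}} {t} →
                 IsSolution A B C N t → t ∈ solutions A B C N
  ∈-solutions⁺ {A} {B} {C} {N} {x , y , z} refl =
    ∈-filter⁺ (isSolution? A B C N) (∈-triplesUpTo x≤ y≤ z≤) refl
    where
    x≤ : x ≤ A * x + B * y + C * z
    x≤ = ≤-trans (m≤n*m x A) (≤-trans (m≤m+n (A * x) (B * y)) (m≤m+n _ (C * z)))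
    y≤ : y ≤ A * x + B * y + C * z
    y≤ = ≤-trans (m≤n*m y B) (≤-trans (m≤n+m (B * y) (A * x)) (m≤m+n _ (C * z)))
    z≤ : z ≤ A * x + B * y + C * z
    z≤ = ≤-trans (m≤n*m z C) (m≤n+m (C * z) _)

  numSolutions-reindex :
    ∀ {a b c A B C n N} .{{_ : NonZero a}} .{{_ : NonZero b}} .{{_ : NonZero c}}
      .{{_ : NonZero A}} .{{_ : NonZero B}} .{{_ : NonZero C}}
    (f : ℕ × ℕ × ℕ → ℕ × ℕ × ℕ) → (∀ {s t} → f s ≡ f t → s ≡ t) →
    (∀ t → IsSolution a b c n (f t) ⇔ IsSolution A B C N t) →
    (∀ v → IsSolution a b c n v → ∃[ t ] v ≡ f t) →
    numSolutions a b c n ≡ numSolutions A B C N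
  numSolutions-reindex {a} {b} {c} {A} {B} {C} {n} {N} f f-injective f-solution onto = begin
    length (solutions a b c n)         ≡⟨ ↭-length (∼bag⇒↭ (unique∧set⇒bag unique-S unique-fT same)) ⟩
    length (map f (solutions A B C N)) ≡⟨ length-map f (solutions A B C N) ⟩
    length (solutions A B C N)         ∎
    where
    open ≡-Reasoning
    unique-S : Unique (solutions a b c n)
    unique-S = Unique.filter⁺ (isSolution? a b c n) (triplesUpTo-unique ∣ n ∣)
    unique-fT : Unique (map f (solutions A B C N))
    unique-fT = Unique.map⁺ f-injective (Unique.filter⁺ (isSolution? A B C N) (triplesUpTo-unique ∣ N ∣))
    to : ∀ {v} → v ∈ solutions a b c n → v ∈ map f (solutions A B C N)
    to {v} v∈ with onto v (∈-solutions⁻ a b c n v∈)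
    ... | t , refl = ∈-map⁺ f (∈-solutions⁺ (Equivalence.to (f-solution t) (∈-solutions⁻ a b c n v∈)))
    from : ∀ {v} → v ∈ map f (solutions A B C N) → v ∈ solutions a b c n
    from v∈ with ∈-map⁻ f v∈
    ... | t , t∈ , refl = ∈-solutions⁺ (Equivalence.from (f-solution t) (∈-solutions⁻ A B C N t∈))
    same : ∀ {v} → v ∈ solutions a b c n ⇔ v ∈ map f (solutions A B C N)
    same = mk⇔ to from

module Coprimality where
  open import Data.Nat using (_*_)
  open import Data.Nat.Properties using (*-comm; *-identityˡ)
  open import Data.Nat.Divisibility using (_∣_; ∣-trans; ∣1⇒≡1)
  open import Data.Nat.GCD using (gcd; gcd[m,n]∣m; gcd[m,n]∣n; gcd-greatest)
  open import Data.Nat.LCM using (lcm; lcm-least; gcd*lcm)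
  open import Data.Nat.Coprimality using (Coprime; coprime⇒gcd≡1; coprime-divisor)
  open import Data.Product using (_,_)
  open import Relation.Binary.PropositionalEquality using (_≡_; sym; trans; subst)

  coprime⇒*∣ : ∀ {m n k} → Coprime m n → m ∣ k → n ∣ k → m * n ∣ k
  coprime⇒*∣ {m} {n} coprime m∣k n∣k = subst (_∣ _) lcm≡m*n (lcm-least m∣k n∣k)
    where
    lcm≡m*n : lcm m n ≡ m * n
    lcm≡m*n = trans (sym (*-identityˡ (lcm m n)))
                    (subst (λ d → d * lcm m n ≡ m * n) (coprime⇒gcd≡1 coprime) (gcd*lcm m n))

  coprime-*ˡ : ∀ {m n o} → Coprime m o → Coprime n o → Coprime (m * n) o
  coprime-*ˡ {m} {n} m⊥o n⊥o {i} (i∣mn , i∣o) =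
    m⊥o (coprime-divisor i⊥n (subst (i ∣_) (*-comm m n) i∣mn) , i∣o)
    where
    i⊥n : Coprime i n
    i⊥n (j∣i , j∣n) = n⊥o (j∣n , ∣-trans j∣i i∣o)

  gcd-coprime : ∀ {a b c} → (∀ {d} → d ∣ a → d ∣ b → d ∣ c → d ≡ 1) → Coprime (gcd b c) (gcd c a)
  gcd-coprime {a} {b} {c} only-1-divides (d∣g₁ , d∣g₂) =
    only-1-divides (∣-trans d∣g₂ (gcd[m,n]∣n c a)) (∣-trans d∣g₁ (gcd[m,n]∣m b c)) (∣-trans d∣g₁ (gcd[m,n]∣n b c))

  common-divisor≡1 : ∀ {a b c d} → gcd a (gcd b c) ≡ 1 → d ∣ a → d ∣ b → d ∣ c → d ≡ 1
  common-divisor≡1 gcd≡1 d∣a d∣b d∣c = ∣1⇒≡1 (subst (_ ∣_) gcd≡1 (gcd-greatest d∣a (gcd-greatest d∣b d∣c)))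

module Arithmetic where
  open import Data.Nat using (_+_; _*_; NonZero)
  open import Data.Nat.Properties using (m*n≢0⇒m≢0)
  open import Data.Nat.Tactic.RingSolver using (solve-∀)
  open import Relation.Binary.PropositionalEquality using (_≡_; refl; subst)

  factor-nonZero : ∀ {m n k} {{_ : NonZero m}} → m ≡ n * k → NonZero n
  factor-nonZero {m} {n} {{m≢0}} m≡nk = m*n≢0⇒m≢0 n {{subst NonZero m≡nk m≢0}}

  +-rotate : ∀ p q r → p + q + r ≡ q + r + p
  +-rotate = solve-∀

  linear-form-shift : ∀ {a b c} A B C g₁ g₂ g₃ r₁ r₂ r₃ x y z →
    a ≡ A * (g₂ * g₃) → b ≡ B * (g₃ * g₁) → c ≡ C * (g₁ * g₂) →
    a * (r₁ + x * g₁) + b * (r₂ + y * g₂) + c * (r₃ + z * g₃)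
      ≡ a * r₁ + b * r₂ + c * r₃ + (A * x + B * y + C * z) * (g₁ * g₂ * g₃)
  linear-form-shift A B C g₁ g₂ g₃ r₁ r₂ r₃ x y z refl refl refl = identity A B C g₁ g₂ g₃ r₁ r₂ r₃ x y z
    where
    identity : ∀ A B C g₁ g₂ g₃ r₁ r₂ r₃ x y z →
      A * (g₂ * g₃) * (r₁ + x * g₁) + B * (g₃ * g₁) * (r₂ + y * g₂) + C * (g₁ * g₂) * (r₃ + z * g₃)
        ≡ A * (g₂ * g₃) * r₁ + B * (g₃ * g₁) * r₂ + C * (g₁ * g₂) * r₃ + (A * x + B * y + C * z) * (g₁ * g₂ * g₃)
    identity = solve-∀

module Congruences where
  open import Data.Nat as ℕ using (ℕ; suc; NonZero; _<_)
  import Data.Nat.Properties as ℕ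
  open import Data.Integer using (ℤ; +_; -[1+_]; _+_; _*_; _-_; -_; 1ℤ; _%ℕ_; _/ℕ_)
  import Data.Integer.Divisibility as Unsigned
  open import Data.Integer.Divisibility.Signed
    using (_∣_; divides; ∣-trans; ∣-reflexive; ∣m∣n⇒∣m+n; ∣m∣n⇒∣m-n; ∣m⇒∣m*n; ∣n⇒∣m*n; ∣ᵤ⇒∣)
  open import Data.Integer.DivMod using (a≡a%ℕn+[a/ℕn]*n; n%ℕd<d)
  open import Data.Integer.Properties using (pos-+; pos-*; +-injective; +-identityˡ; *-cancelʳ-≡)
  open import Function.Bundles using (_⇔_; mk⇔)
  open import Data.Integer.Tactic.RingSolver using (solve-∀)
  open import Data.Nat.Divisibility as ℕ using (n∣m⇒m%n≡0)
  open import Data.Product using (_,_; ∃-syntax)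
  open import Data.Empty using (⊥-elim)
  open import Relation.Binary.PropositionalEquality using (_≡_; refl; sym; trans; cong; cong₂; subst; module ≡-Reasoning)

  private
    variable
      g a a′ m r x : ℤ

  ∣-inverse⇒∣-sub : g ∣ a * a′ - 1ℤ → g ∣ m * a′ - r → g ∣ m - a * x → g ∣ x - r
  ∣-inverse⇒∣-sub {g} {a} {a′} {m} {r} {x} aa′≡1 ma′≡r m≡ax =
    ∣-trans (∣m∣n⇒∣m-n (∣m∣n⇒∣m-n ma′≡r (∣m⇒∣m*n a′ m≡ax)) (∣n⇒∣m*n x aa′≡1))
            (∣-reflexive (identity m a′ r a x))
    where
    identity : ∀ m a′ r a x → (m * a′ - r) - (m - a * x) * a′ - x * (a * a′ - 1ℤ) ≡ x - r
    identity = solve-∀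

  ∣-inverse⇒∣-residual : g ∣ a * a′ - 1ℤ → g ∣ m * a′ - r → g ∣ m - a * r
  ∣-inverse⇒∣-residual {g} {a} {a′} {m} {r} aa′≡1 ma′≡r =
    ∣-trans (∣m∣n⇒∣m-n (∣n⇒∣m*n a ma′≡r) (∣n⇒∣m*n m aa′≡1)) (∣-reflexive (identity m a′ r a))
    where
    identity : ∀ m a′ r a → a * (m * a′ - r) - m * (a * a′ - 1ℤ) ≡ m - a * r
    identity = solve-∀

  ∣-sub-%ℕ : ∀ X d .{{_ : NonZero d}} → + d ∣ X - + (X %ℕ d)
  ∣-sub-%ℕ X d = divides (X /ℕ d) (begin
    X - + (X %ℕ d)                         ≡⟨ cong (_- + (X %ℕ d)) (a≡a%ℕn+[a/ℕn]*n X d) ⟩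
    + (X %ℕ d) + X /ℕ d * + d - + (X %ℕ d) ≡⟨ identity (+ (X %ℕ d)) (X /ℕ d * + d) ⟩
    X /ℕ d * + d                           ∎)
    where
    open ≡-Reasoning
    identity : ∀ r s → r + s - r ≡ s
    identity = solve-∀

  ∣⇒%ℕ≡0 : ∀ X d .{{_ : NonZero d}} → + d Unsigned.∣ X → X %ℕ d ≡ 0
  ∣⇒%ℕ≡0 (+ m)    d d∣m = n∣m⇒m%n≡0 m d d∣m
  ∣⇒%ℕ≡0 -[1+ m ] d d∣m with suc m ℕ.% d | n∣m⇒m%n≡0 (suc m) d d∣m
  ... | ℕ.zero | _ = refl
  -- the clause for a nonzero remainder of suc m is absurd, hence omitted

  [n/ℕd]*d≡n : ∀ X d .{{_ : NonZero d}} → + d Unsigned.∣ X → X /ℕ d * + d ≡ X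
  [n/ℕd]*d≡n X d d∣X = sym (begin
    X                            ≡⟨ a≡a%ℕn+[a/ℕn]*n X d ⟩
    + (X %ℕ d) + X /ℕ d * + d    ≡⟨ cong (λ r → + r + X /ℕ d * + d) (∣⇒%ℕ≡0 X d d∣X) ⟩
    + 0 + X /ℕ d * + d           ≡⟨ +-identityˡ _ ⟩
    X /ℕ d * + d                 ∎)
    where open ≡-Reasoning

  nonnegative-quotient : ∀ {g} x r q → r < g → + x ≡ + r + q * + g → ∃[ k ] x ≡ r ℕ.+ k ℕ.* g
  nonnegative-quotient {g} x r (+ k) r<g x≡r+kg =
    k , +-injective (trans x≡r+kg (sym (trans (pos-+ r _) (cong (_+_ (+ r)) (pos-* k g)))))
  nonnegative-quotient {g} x r -[1+ k ] r<g x≡r-[1+k]g =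
    ⊥-elim (ℕ.<⇒≱ r<g (ℕ.≤-trans (ℕ.m≤n*m g (suc k)) (subst (suc k ℕ.* g ℕ.≤_) x+[1+k]g≡r (ℕ.m≤n+m _ x))))
    where
    x+[1+k]g≡r : x ℕ.+ suc k ℕ.* g ≡ r
    x+[1+k]g≡r = +-injective (begin
      + (x ℕ.+ suc k ℕ.* g)                 ≡⟨ trans (pos-+ x _) (cong (_+_ (+ x)) (pos-* (suc k) g)) ⟩
      + x + + suc k * + g                   ≡⟨ cong (_+ + suc k * + g) x≡r-[1+k]g ⟩
      + r + - + suc k * + g + + suc k * + g ≡⟨ identity (+ r) (+ suc k) (+ g) ⟩
      + r                                   ∎)
      where
      open ≡-Reasoning
      identity : ∀ r k g → r + - k * g + k * g ≡ r
      identity = solve-∀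

  residue-decomposition : ∀ {g} x r → r < g → + g ∣ + x - + r → ∃[ k ] x ≡ r ℕ.+ k ℕ.* g
  residue-decomposition x r r<g (divides q x-r≡qg) =
    nonnegative-quotient x r q r<g (trans (identity (+ x) (+ r)) (cong (_+_ (+ r)) x-r≡qg))
    where
    identity : ∀ x r → x ≡ r + (x - r)
    identity = solve-∀

  pos-linear : ∀ a x b y c z →
    + (a ℕ.* x ℕ.+ b ℕ.* y ℕ.+ c ℕ.* z) ≡ + a * + x + + b * + y + + c * + z
  pos-linear a x b y c z = begin
    + (a ℕ.* x ℕ.+ b ℕ.* y ℕ.+ c ℕ.* z)         ≡⟨ pos-+ (a ℕ.* x ℕ.+ b ℕ.* y) (c ℕ.* z) ⟩
    + (a ℕ.* x ℕ.+ b ℕ.* y) + + (c ℕ.* z)       ≡⟨ cong (_+ + (c ℕ.* z)) (pos-+ (a ℕ.* x) (b ℕ.* y)) ⟩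
    + (a ℕ.* x) + + (b ℕ.* y) + + (c ℕ.* z)     ≡⟨ cong₂ _+_ (cong₂ _+_ (pos-* a x) (pos-* b y)) (pos-* c z) ⟩
    + a * + x + + b * + y + + c * + z           ∎
    where open ≡-Reasoning

  ∣-pos-* : ∀ {g} m n → g ℕ.∣ m → + g ∣ + (m ℕ.* n)
  ∣-pos-* {g} m n g∣m = subst (+ g ∣_) (sym (pos-* m n)) (∣m⇒∣m*n (+ n) (∣ᵤ⇒∣ {+ g} {+ m} g∣m))

  module _ {g b c : ℕ} .{{_ : NonZero g}} (a : ℕ) (a′ : ℤ)
           (g∣b : g ℕ.∣ b) (g∣c : g ℕ.∣ c) (a-invertible : + g ∣ + a * a′ - 1ℤ) where

    solution-residue : ∀ {n} x y z → a ℕ.* x ℕ.+ b ℕ.* y ℕ.+ c ℕ.* z ≡ n →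
                       ∃[ k ] x ≡ (+ n * a′) %ℕ g ℕ.+ k ℕ.* g
    solution-residue {n} x y z refl =
      residue-decomposition x _ (n%ℕd<d (+ n * a′) g)
        (∣-inverse⇒∣-sub {a = + a} {m = + n} {x = + x} a-invertible (∣-sub-%ℕ (+ n * a′) g) n-ax)
      where
      identity : ∀ p q r → q + r ≡ p + q + r - p
      identity = solve-∀
      n-ax : + g ∣ + n - + a * + x
      n-ax = subst (λ e → + g ∣ e - + a * + x) (sym (pos-linear a x b y c z))
               (subst (+ g ∣_) (identity (+ a * + x) (+ b * + y) (+ c * + z))
                 (∣m∣n⇒∣m+n (∣m⇒∣m*n (+ y) (∣ᵤ⇒∣ {+ g} {+ b} g∣b)) (∣m⇒∣m*n (+ z) (∣ᵤ⇒∣ {+ g} {+ c} g∣c))))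

    residual-divisible : ∀ n s t →
      + g ∣ + n - + (a ℕ.* ((+ n * a′) %ℕ g)) - + (b ℕ.* s) - + (c ℕ.* t)
    residual-divisible n s t =
      ∣m∣n⇒∣m-n (∣m∣n⇒∣m-n n-ar (∣-pos-* b s g∣b)) (∣-pos-* c t g∣c)
      where
      n-ar : + g ∣ + n - + (a ℕ.* ((+ n * a′) %ℕ g))
      n-ar = subst (λ e → + g ∣ + n - e) (sym (pos-* a _))
               (∣-inverse⇒∣-residual {a = + a} {m = + n} a-invertible (∣-sub-%ℕ (+ n * a′) g))

  offset-scale-⇔ : ∀ {n P G S} {N : ℤ} .{{_ : NonZero G}} → + n - + P ≡ N * + G →
                   (+ (P ℕ.+ S ℕ.* G) ≡ + n ⇔ + S ≡ N)
  offset-scale-⇔ {n} {P} {G} {S} {N} n-P≡NG = mk⇔ to from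
    where
    open ≡-Reasoning
    pos-P+SG : + (P ℕ.+ S ℕ.* G) ≡ + P + + S * + G
    pos-P+SG = trans (pos-+ P _) (cong (_+_ (+ P)) (pos-* S G))
    to : + (P ℕ.+ S ℕ.* G) ≡ + n → + S ≡ N
    to P+SG≡n = *-cancelʳ-≡ (+ S) N (+ G) (begin
      + S * + G                      ≡⟨ identity (+ P) (+ S * + G) ⟩
      + P + + S * + G - + P          ≡⟨ cong (_- + P) (trans (sym pos-P+SG) P+SG≡n) ⟩
      + n - + P                      ≡⟨ n-P≡NG ⟩
      N * + G                        ∎)
      where
      identity : ∀ p q → q ≡ p + q - p
      identity = solve-∀
    from : + S ≡ N → + (P ℕ.+ S ℕ.* G) ≡ + n
    from refl = begin
      + (P ℕ.+ S ℕ.* G)              ≡⟨ pos-P+SG ⟩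
      + P + + S * + G                ≡⟨ cong (_+_ (+ P)) (sym n-P≡NG) ⟩
      + P + (+ n - + P)              ≡⟨ identity (+ P) (+ n) ⟩
      + n                            ∎
      where
      identity : ∀ p n → p + (n - p) ≡ n
      identity = solve-∀

open import Data.Nat using (ℕ; NonZero; _/_)
open import Data.Nat.GCD using (gcd)
open import Data.Integer using (ℤ; +_; _*_; _-_; 1ℤ; _/ℕ_; _%ℕ_)
open import Data.Integer.Divisibility using (_∣_)
open import Data.Product using (_×_)
open import Relation.Binary.PropositionalEquality using (_≡_)
open import Data.Product using (_,_)

module Reduction
  (a b c n : ℕ) {{_ : NonZero a}} {{_ : NonZero b}} {{_ : NonZero c}}
  (gcd≡1 : gcd a (gcd b c) ≡ 1) (a₁ b₂ c₃ : ℤ)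
  (a₁-inverse : + gcd b c ∣ + a * a₁ - 1ℤ)
  (b₂-inverse : + gcd c a ∣ + b * b₂ - 1ℤ)
  (c₃-inverse : + gcd a b ∣ + c * c₃ - 1ℤ)
  where

  import Data.Nat as ℕ
  import Data.Nat.Properties as ℕ
  import Data.Nat.Divisibility as ℕ
  open import Data.Nat.DivMod using (m/n*n≡m)
  open import Data.Nat.GCD using (gcd[m,n]∣m; gcd[m,n]∣n)
  open import Data.Nat.Coprimality as Coprime using (Coprime)
  open import Data.Integer using (_+_)
  open import Data.Integer.Divisibility.Signed using (∣ᵤ⇒∣; ∣⇒∣ᵤ)
  open import Data.Integer.Properties using (pos-+; +-injective)
  open import Data.Integer.Tactic.RingSolver using (solve-∀)
  open import Data.Product using (proj₁; proj₂; ∃-syntax)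
  open import Function.Base using (_∘_)
  open import Function.Bundles using (_⇔_)
  open import Relation.Binary.PropositionalEquality using (refl; sym; trans; cong; cong₂; subst; module ≡-Reasoning)
  open Enumeration
  open Coprimality
  open Arithmetic
  open Congruences

  g₁ g₂ g₃ : ℕ
  g₁ = gcd b c
  g₂ = gcd c a
  g₃ = gcd a b

  instance
    g₁≢0 : ℕ.NonZero g₁
    g₁≢0 = gcd-nonZero b c
    g₂≢0 : ℕ.NonZero g₂
    g₂≢0 = gcd-nonZero c a
    g₃≢0 : ℕ.NonZero g₃
    g₃≢0 = gcd-nonZero a b
    g₂g₃≢0 : ℕ.NonZero (g₂ ℕ.* g₃)
    g₂g₃≢0 = mul-nonZero g₂ g₃
    g₃g₁≢0 : ℕ.NonZero (g₃ ℕ.* g₁)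
    g₃g₁≢0 = mul-nonZero g₃ g₁
    g₁g₂≢0 : ℕ.NonZero (g₁ ℕ.* g₂)
    g₁g₂≢0 = mul-nonZero g₁ g₂
    G≢0 : ℕ.NonZero (g₁ ℕ.* g₂ ℕ.* g₃)
    G≢0 = mul-nonZero (g₁ ℕ.* g₂) g₃

  n₁ n₂ n₃ A B C G : ℕ
  n₁ = (+ n * a₁) %ℕ g₁
  n₂ = (+ n * b₂) %ℕ g₂
  n₃ = (+ n * c₃) %ℕ g₃
  A = a / (g₂ ℕ.* g₃)
  B = b / (g₃ ℕ.* g₁)
  C = c / (g₁ ℕ.* g₂)
  G = g₁ ℕ.* g₂ ℕ.* g₃
  D N : ℤ
  D = + n - + (a ℕ.* n₁) - + (b ℕ.* n₂) - + (c ℕ.* n₃)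
  N = D /ℕ G

  only-1-divides : ∀ {d} → d ℕ.∣ a → d ℕ.∣ b → d ℕ.∣ c → d ≡ 1
  only-1-divides = common-divisor≡1 gcd≡1

  g₁⊥g₂ : Coprime g₁ g₂
  g₁⊥g₂ = gcd-coprime only-1-divides
  g₂⊥g₃ : Coprime g₂ g₃
  g₂⊥g₃ = gcd-coprime (λ d∣b d∣c d∣a → only-1-divides d∣a d∣b d∣c)
  g₃⊥g₁ : Coprime g₃ g₁
  g₃⊥g₁ = gcd-coprime (λ d∣c d∣a d∣b → only-1-divides d∣a d∣b d∣c)

  a≡A*g₂g₃ : a ≡ A ℕ.* (g₂ ℕ.* g₃)
  a≡A*g₂g₃ = sym (m/n*n≡m (coprime⇒*∣ g₂⊥g₃ (gcd[m,n]∣n c a) (gcd[m,n]∣m a b)))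
  b≡B*g₃g₁ : b ≡ B ℕ.* (g₃ ℕ.* g₁)
  b≡B*g₃g₁ = sym (m/n*n≡m (coprime⇒*∣ g₃⊥g₁ (gcd[m,n]∣n a b) (gcd[m,n]∣m b c)))
  c≡C*g₁g₂ : c ≡ C ℕ.* (g₁ ℕ.* g₂)
  c≡C*g₁g₂ = sym (m/n*n≡m (coprime⇒*∣ g₁⊥g₂ (gcd[m,n]∣n b c) (gcd[m,n]∣m c a)))

  instance
    A≢0 : ℕ.NonZero A
    A≢0 = factor-nonZero a≡A*g₂g₃
    B≢0 : ℕ.NonZero B
    B≢0 = factor-nonZero b≡B*g₃g₁
    C≢0 : ℕ.NonZero C
    C≢0 = factor-nonZero c≡C*g₁g₂

  g₁∣D : + g₁ ∣ D
  g₁∣D = ∣⇒∣ᵤ (residual-divisible a a₁ (gcd[m,n]∣m b c) (gcd[m,n]∣n b c) (∣ᵤ⇒∣ a₁-inverse) n n₂ n₃)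
  g₂∣D : + g₂ ∣ D
  g₂∣D = subst (+ g₂ ∣_) (identity (+ n) (+ (a ℕ.* n₁)) (+ (b ℕ.* n₂)) (+ (c ℕ.* n₃)))
           (∣⇒∣ᵤ (residual-divisible b b₂ (gcd[m,n]∣m c a) (gcd[m,n]∣n c a) (∣ᵤ⇒∣ b₂-inverse) n n₃ n₁))
    where
    identity : ∀ m p q r → m - q - r - p ≡ m - p - q - r
    identity = solve-∀
  g₃∣D : + g₃ ∣ D
  g₃∣D = subst (+ g₃ ∣_) (identity (+ n) (+ (a ℕ.* n₁)) (+ (b ℕ.* n₂)) (+ (c ℕ.* n₃)))
           (∣⇒∣ᵤ (residual-divisible c c₃ (gcd[m,n]∣m a b) (gcd[m,n]∣n a b) (∣ᵤ⇒∣ c₃-inverse) n n₁ n₂))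
    where
    identity : ∀ m p q r → m - r - p - q ≡ m - p - q - r
    identity = solve-∀

  G∣D : + G ∣ D
  G∣D = coprime⇒*∣ (coprime-*ˡ (Coprime.sym g₃⊥g₁) g₂⊥g₃) (coprime⇒*∣ g₁⊥g₂ g₁∣D g₂∣D) g₃∣D

  P : ℕ
  P = a ℕ.* n₁ ℕ.+ b ℕ.* n₂ ℕ.+ c ℕ.* n₃

  n-P≡N*G : + n - + P ≡ N * + G
  n-P≡N*G = begin
    + n - + P                                              ≡⟨ cong (_-_ (+ n)) (pos-+ (a ℕ.* n₁ ℕ.+ b ℕ.* n₂) _) ⟩
    + n - (+ (a ℕ.* n₁ ℕ.+ b ℕ.* n₂) + + (c ℕ.* n₃))       ≡⟨ cong (λ e → + n - (e + + (c ℕ.* n₃))) (pos-+ (a ℕ.* n₁) _) ⟩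
    + n - (+ (a ℕ.* n₁) + + (b ℕ.* n₂) + + (c ℕ.* n₃))     ≡⟨ identity (+ n) (+ (a ℕ.* n₁)) (+ (b ℕ.* n₂)) (+ (c ℕ.* n₃)) ⟩
    D                                                      ≡⟨ [n/ℕd]*d≡n D G G∣D ⟨
    N * + G                                                ∎
    where
    open ≡-Reasoning
    identity : ∀ m p q r → m - (p + q + r) ≡ m - p - q - r
    identity = solve-∀

  shift : ℕ × ℕ × ℕ → ℕ × ℕ × ℕ
  shift (x , y , z) = n₁ ℕ.+ x ℕ.* g₁ , n₂ ℕ.+ y ℕ.* g₂ , n₃ ℕ.+ z ℕ.* g₃

  shift-injective : ∀ {s t} → shift s ≡ shift t → s ≡ t
  shift-injective {x , y , z} {x′ , y′ , z′} eq =
    cong₂ _,_ (cancel n₁ g₁ (cong proj₁ eq))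
              (cong₂ _,_ (cancel n₂ g₂ (cong (proj₁ ∘ proj₂) eq)) (cancel n₃ g₃ (cong (proj₂ ∘ proj₂) eq)))
    where
    cancel : ∀ r g .{{_ : ℕ.NonZero g}} {u v} → r ℕ.+ u ℕ.* g ≡ r ℕ.+ v ℕ.* g → u ≡ v
    cancel r g {u} {v} eq = ℕ.*-cancelʳ-≡ u v g (ℕ.+-cancelˡ-≡ r _ _ eq)

  shift-solution : ∀ t → IsSolution a b c (+ n) (shift t) ⇔ IsSolution A B C N t
  shift-solution (x , y , z) =
    subst (λ m → (+ m ≡ + n) ⇔ IsSolution A B C N (x , y , z))
          (sym (linear-form-shift A B C g₁ g₂ g₃ n₁ n₂ n₃ x y z a≡A*g₂g₃ b≡B*g₃g₁ c≡C*g₁g₂))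
          (offset-scale-⇔ n-P≡N*G)

  residues-in-image : ∀ {x y z} → a ℕ.* x ℕ.+ b ℕ.* y ℕ.+ c ℕ.* z ≡ n → ∃[ t ] (x , y , z) ≡ shift t
  residues-in-image {x} {y} {z} ax+by+cz≡n
    with x′ , refl ← solution-residue a a₁ (gcd[m,n]∣m b c) (gcd[m,n]∣n b c) (∣ᵤ⇒∣ a₁-inverse) x y z ax+by+cz≡n
       | y′ , refl ← solution-residue b b₂ (gcd[m,n]∣m c a) (gcd[m,n]∣n c a) (∣ᵤ⇒∣ b₂-inverse) y z x
                       (trans (sym (+-rotate (a ℕ.* x) _ _)) ax+by+cz≡n)
       | z′ , refl ← solution-residue c c₃ (gcd[m,n]∣m a b) (gcd[m,n]∣n a b) (∣ᵤ⇒∣ c₃-inverse) z x y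
                       (trans (+-rotate (c ℕ.* z) _ _) ax+by+cz≡n)
    = (x′ , y′ , z′) , refl

  solution-in-image : ∀ v → IsSolution a b c (+ n) v → ∃[ t ] v ≡ shift t
  solution-in-image _ sol = residues-in-image (+-injective sol)

  numSolutions-preserved : numSolutions a b c (+ n) ≡ numSolutions A B C N
  numSolutions-preserved = numSolutions-reindex shift shift-injective shift-solution solution-in-image

lemma3 : (a b c n : ℕ) → {{_ : NonZero a}} → {{_ : NonZero b}} → {{_ : NonZero c}} → {{_ : NonZero n}} →
         gcd a (gcd b c) ≡ 1 →
         (a₁ b₂ c₃ : ℤ) →
         (+ gcd b c) ∣ (+ a * a₁ - 1ℤ) →
         (+ gcd c a) ∣ (+ b * b₂ - 1ℤ) →
         (+ gcd a b) ∣ (+ c * c₃ - 1ℤ) →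
         let g₁ = gcd b c
             g₂ = gcd c a
             g₃ = gcd a b
             instance
               g₁≢0 : NonZero g₁
               g₁≢0 = gcd-nonZero b c
               g₂≢0 : NonZero g₂
               g₂≢0 = gcd-nonZero c a
               g₃≢0 : NonZero g₃
               g₃≢0 = gcd-nonZero a b
               g₂g₃≢0 : NonZero (g₂ Data.Nat.* g₃)
               g₂g₃≢0 = mul-nonZero g₂ g₃
               g₃g₁≢0 : NonZero (g₃ Data.Nat.* g₁)
               g₃g₁≢0 = mul-nonZero g₃ g₁
               g₁g₂≢0 : NonZero (g₁ Data.Nat.* g₂)
               g₁g₂≢0 = mul-nonZero g₁ g₂
               G≢0 : NonZero (g₁ Data.Nat.* g₂ Data.Nat.* g₃)
               G≢0 = mul-nonZero (g₁ Data.Nat.* g₂) g₃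
             n₁ = (+ n * a₁) %ℕ g₁
             n₂ = (+ n * b₂) %ℕ g₂
             n₃ = (+ n * c₃) %ℕ g₃
             A = a / (g₂ Data.Nat.* g₃)
             B = b / (g₃ Data.Nat.* g₁)
             C = c / (g₁ Data.Nat.* g₂)
             G = g₁ Data.Nat.* g₂ Data.Nat.* g₃
             D = + n - + (a Data.Nat.* n₁) - + (b Data.Nat.* n₂) - + (c Data.Nat.* n₃)
             N = D /ℕ G
         in (+ G ∣ D) × numSolutions a b c (+ n) ≡ numSolutions A B C N
lemma3 a b c n gcd≡1 a₁ b₂ c₃ a₁-inverse b₂-inverse c₃-inverse = G∣D , numSolutions-preserved
  where
  open Reduction a b c n gcd≡1 a₁ b₂ c₃ a₁-inverse b₂-inverse c₃-inverse
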